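{- Let $d\ge 0$ and $r\ge 1$ be integers and let $\nu=(\nu(1),\ldots,\nu(r))$ be an $r$-tuple of integers. Then \[ \sum_{k=0}^{\infty}(d)_k\sum_{s\in S(\nu,k)}\frac{1}{\prod_{\emptyset\neq U\subseteq[r]} s(U)!}\;=\;\prod_{i=1}^r\binom{d}{\nu(i)}. \]
   Context: $(d)_k=d(d-1)\cdots(d-k+1)$ is the falling factorial, and $\binom{d}{n}=0$ for $n<0$. For an integer $k$, $S(\nu,k)$ is the set of $(2^r-1)$-tuples $s=(s(U))_{\emptyset\ne U\subseteq[r]}$ of nonnegative integers, indexed by the nonempty subsets $U$ of $[r]=\{1,\ldots,r\}$, such that $\nu(i)=\sum_{U\ni i}s(U)$ for each $1\le i\le r$ and $k=\sum_{\emptyset\ne U\subseteq[r]}s(U)$. -}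

module Defs where

open import Data.Nat using (ℕ; zero; suc; _≤_; NonZero; _!)
  renaming (_+_ to _+ℕ_; _*_ to _*ℕ_)
open import Data.Nat.Properties using (_!≢0; m*n≢0)
open import Data.Nat.Combinatorics using (_C_; _P_)
open import Data.Integer using (ℤ; +_; -[1+_])
import Data.Integer.Properties as ℤP
open import Data.Rational using (ℚ; _/_; 0ℚ; 1ℚ) renaming (_+_ to _+ℚ_; _*_ to _*ℚ_)
open import Data.Fin using (Fin)
open import Data.Fin.Properties using (all?)
open import Data.Fin.Subset using (Subset; inside; outside)
open import Data.Fin.Subset.Properties using (nonempty?; _∈?_)
open import Data.Vec using ([]; _∷_)
import Data.Vec.Properties as VecP
open import Data.Bool using (if_then_else_)
import Data.Bool.Properties as BoolP
open import Data.List using (List; []; _∷_; [_]; map; _++_; filter; concatMap; upTo; foldr)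
open import Data.Product using (_×_)
open import Relation.Nullary using (Dec; does)
open import Relation.Nullary.Decidable using (_×-dec_)
open import Relation.Binary.PropositionalEquality using (_≡_)

allSubsets : (r : ℕ) → List (Subset r)
allSubsets zero    = [ [] ]
allSubsets (suc r) = map (outside ∷_) (allSubsets r) ++ map (inside ∷_) (allSubsets r)

nonemptySubsets : (r : ℕ) → List (Subset r)
nonemptySubsets r = filter nonempty? (allSubsets r)

-- A tuple s = (s(U)) indexed by nonempty subsets U ⊆ [r] is represented by a
-- function Subset r → ℕ; only its values on nonempty subsets are ever used.
Tuple : ℕ → Set
Tuple r = Subset r → ℕ

sumℕ : List ℕ → ℕ
sumℕ = foldr _+ℕ_ 0

productℕ : List ℕ → ℕ
productℕ = foldr _*ℕ_ 1

sumℚ : List ℚ → ℚ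
sumℚ = foldr _+ℚ_ 0ℚ

coverSum : {r : ℕ} → Tuple r → Fin r → ℕ
coverSum {r} s i = sumℕ (map s (filter (i ∈?_) (nonemptySubsets r)))

totalSum : {r : ℕ} → Tuple r → ℕ
totalSum {r} s = sumℕ (map s (nonemptySubsets r))

InS : {r : ℕ} → (Fin r → ℤ) → ℕ → Tuple r → Set
InS ν k s = ((i : Fin _) → + (coverSum s i) ≡ ν i) × (totalSum s ≡ k)

InS? : {r : ℕ} (ν : Fin r → ℤ) (k : ℕ) (s : Tuple r) → Dec (InS ν k s)
InS? ν k s = all? (λ i → + (coverSum s i) ℤP.≟ ν i) ×-dec (totalSum s Data.Nat.≟ k)
  where import Data.Nat

-- Every s ∈ S(ν,k) has all values ≤ k (their sum is k), so S(ν,k) is exactly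
-- the set of enumerated tuples satisfying InS ν k (each listed once).
update : {r : ℕ} → Subset r → ℕ → Tuple r → Tuple r
update U v f W = if does (VecP.≡-dec BoolP._≟_ W U) then v else f W

assignments : {r : ℕ} → List (Subset r) → ℕ → List (Tuple r)
assignments []       k = [ (λ _ → 0) ]
assignments (U ∷ Us) k =
  concatMap (λ v → map (update U v) (assignments Us k)) (upTo (suc k))

factProd : {r : ℕ} → Tuple r → ℕ
factProd {r} s = productℕ (map (λ U → s U !) (nonemptySubsets r))

factProdList≢0 : {r : ℕ} (s : Tuple r) (Us : List (Subset r)) →
                 NonZero (productℕ (map (λ U → s U !) Us))
factProdList≢0 s []       = _
factProdList≢0 s (U ∷ Us) = m*n≢0 _ _ {{s U !≢0}} {{factProdList≢0 s Us}}

invFactProd : {r : ℕ} → Tuple r → ℚ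
invFactProd {r} s = ((+ 1) / factProd s) {{factProdList≢0 s (nonemptySubsets r)}}

innerSum : {r : ℕ} → (Fin r → ℤ) → ℕ → ℚ
innerSum {r} ν k =
  sumℚ (map (λ s → if does (InS? ν k s) then invFactProd s else 0ℚ)
            (assignments (nonemptySubsets r) k))

ℕtoℚ : ℕ → ℚ
ℕtoℚ n = (+ n) / 1

-- falling factorial (d)_k = d(d-1)⋯(d-k+1)  (stdlib's d P k, which is 0 for k > d)
falling : ℕ → ℕ → ℕ
falling d k = d P k

partialSum : {r : ℕ} → ℕ → (Fin r → ℤ) → ℕ → ℚ
partialSum d ν M = sumℚ (map (λ k → ℕtoℚ (falling d k) *ℚ innerSum ν k) (upTo (suc M)))

binomℤ : ℕ → ℤ → ℕ
binomℤ d (+ n)     = d C n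
binomℤ d -[1+ n ]  = 0

rhs : {r : ℕ} → ℕ → (Fin r → ℤ) → ℚ
rhs {r} d ν = ℕtoℚ (productℕ (Data.List.map (λ i → binomℤ d (ν i)) (Data.List.allFin r)))
  where import Data.List

-- Each term (d)_k / ∏ s(U)! is a natural number, the multinomial coefficient counting
-- disjoint blocks B_U ⊆ [d] with |B_U| = s(U).  Hence the series counts maps φ from [d]
-- to the subsets of [r] (points in no block go to ∅) such that exactly ν(i) points x
-- have i ∈ φ(x); as (d)_k = 0 for k > d, it is a finite sum.  Such a φ is the same as the
-- family of sets A_i = {x : i ∈ φ(x)} with |A_i| = ν(i), which gives ∏ C(d, ν(i)).
-- Formally the count is computed one block at a time, and the product formula follows by
-- induction on d, letting the last point go to an arbitrary subset W ⊆ [r].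

module Submission where

open import Algebra.Structures using (IsCommutativeSemiring; IsCommutativeRing)
import Algebra.Properties.CommutativeSemigroup as CommutativeSemigroupProperties
open import Data.Bool using (Bool; true; false; if_then_else_)
import Data.Bool.Properties as BoolP
open import Data.Fin using (Fin) renaming (zero to fzero; suc to fsuc)
open import Data.Fin.Properties using (all?; ¬∀⟶∃¬)
open import Data.Fin.Subset using (Subset; inside; outside; ⊥)
open import Data.Fin.Subset.Properties using (nonempty?; _∈?_; ∉⊥)
open import Data.Integer as ℤ using (ℤ; +_; -[1+_])
import Data.Integer.Properties as ℤP
open import Data.Integer.Tactic.RingSolver using (solve-∀)
open import Data.List using (List; []; _∷_; _++_; map; filter; concatMap; foldr; upTo; allFin)
import Data.List.Properties as ListP
open import Data.List.Membership.Propositional using (_∈_)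
open import Data.List.Membership.Propositional.Properties using (∈-allFin; ∈-map⁻)
open import Data.List.Relation.Unary.All as All using (All; []; _∷_)
import Data.List.Relation.Unary.All.Properties as AllP
open import Data.List.Relation.Unary.Any using (here; there)
open import Data.List.Relation.Unary.AllPairs using ([]; _∷_)
open import Data.List.Relation.Unary.Unique.Propositional using (Unique)
import Data.List.Relation.Unary.Unique.Propositional.Properties as UniqueP
open import Data.Nat as ℕ using (ℕ; zero; suc; _≤_; _<_; z≤n; s≤s; _∸_; _!; NonZero)
import Data.Nat.Properties as ℕP
open import Data.Nat.Combinatorics
  using (_C_; _P_; k>n⇒nCk≡0; k>n⇒nPk≡0; nCk≡nPk/k!; nCk+nC[k+1]≡[n+1]C[k+1])
open import Data.Nat.Combinatorics.Base using (_P′_)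
open import Data.Nat.Combinatorics.Specification using (k!∣nP′k)
open import Data.Nat.DivMod using (_/_; m/n*n≡m)
open import Data.Nat.Divisibility using (_∣_)
open import Data.Empty using (⊥-elim)
open import Data.Product using (_×_; _,_; ∃-syntax)
open import Data.Rational as ℚ using (ℚ; 0ℚ; toℚᵘ)
import Data.Rational.Properties as ℚP
open import Data.Rational.Unnormalised as ℚᵘ using (mkℚᵘ; *≡*; _≃_)
import Data.Rational.Unnormalised.Properties as ℚᵘP
import Data.Vec as Vec
open import Data.Vec using (_∷_; _[_]=_)
import Data.Vec.Properties as VecP
open import Function using (_∘_; mk⇔)
open import Relation.Nullary using (Dec; yes; no; does; ¬_)
open import Relation.Nullary.Decidable using (dec-true; dec-false; does-⇔)
open import Relation.Binary.PropositionalEquality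
open import Defs

module ListSum {A : Set} {_+_ _*_ : A → A → A} {0# 1# : A}
               (isCommutativeSemiring : IsCommutativeSemiring _≡_ _+_ _*_ 0# 1#) where

  open IsCommutativeSemiring isCommutativeSemiring
    using (+-assoc; +-comm; +-identityˡ; +-identityʳ; distribˡ; zeroʳ)

  -- Sections are written (_+_ a): with Data.Integer's +_ in scope, (a +_) is ambiguous.

  sum : List A → A
  sum = foldr _+_ 0#

  ∑< : ℕ → (ℕ → A) → A
  ∑< n f = sum (map f (upTo n))

  +-interchange : ∀ a b c d → (a + b) + (c + d) ≡ (a + c) + (b + d)
  +-interchange a b c d = begin
    (a + b) + (c + d) ≡⟨ +-assoc a b (c + d) ⟩
    a + (b + (c + d)) ≡⟨ cong (_+_ a) (sym (+-assoc b c d)) ⟩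
    a + ((b + c) + d) ≡⟨ cong (λ x → a + (x + d)) (+-comm b c) ⟩
    a + ((c + b) + d) ≡⟨ cong (_+_ a) (+-assoc c b d) ⟩
    a + (c + (b + d)) ≡⟨ sym (+-assoc a c (b + d)) ⟩
    (a + c) + (b + d) ∎
    where open ≡-Reasoning

  sum-++ : ∀ xs ys → sum (xs ++ ys) ≡ sum xs + sum ys
  sum-++ []       ys = sym (+-identityˡ (sum ys))
  sum-++ (x ∷ xs) ys = trans (cong (_+_ x) (sum-++ xs ys)) (sym (+-assoc x (sum xs) (sum ys)))

  sum-map-++ : {B : Set} (f : B → A) (xs ys : List B) →
               sum (map f (xs ++ ys)) ≡ sum (map f xs) + sum (map f ys)
  sum-map-++ f xs ys = trans (cong sum (ListP.map-++ f xs ys)) (sum-++ (map f xs) (map f ys))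

  sum-map-zero : {B : Set} {f : B → A} (xs : List B) → (∀ x → f x ≡ 0#) → sum (map f xs) ≡ 0#
  sum-map-zero []       f≡0 = refl
  sum-map-zero (x ∷ xs) f≡0 = trans (cong₂ _+_ (f≡0 x) (sum-map-zero xs f≡0)) (+-identityˡ 0#)

  sum-map-+ : {B : Set} (f g : B → A) (xs : List B) →
              sum (map (λ x → f x + g x) xs) ≡ sum (map f xs) + sum (map g xs)
  sum-map-+ f g []       = sym (+-identityˡ 0#)
  sum-map-+ f g (x ∷ xs) =
    trans (cong (_+_ (f x + g x)) (sum-map-+ f g xs)) (+-interchange (f x) (g x) _ _)

  *-distribˡ-sum-map : {B : Set} (c : A) (f : B → A) (xs : List B) →
                       c * sum (map f xs) ≡ sum (map (λ x → c * f x) xs)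
  *-distribˡ-sum-map c f []       = zeroʳ c
  *-distribˡ-sum-map c f (x ∷ xs) =
    trans (distribˡ c (f x) _) (cong (_+_ (c * f x)) (*-distribˡ-sum-map c f xs))

  sum-map-concatMap : {B C : Set} (f : C → A) (h : B → List C) (xs : List B) →
                      sum (map f (concatMap h xs)) ≡ sum (map (λ x → sum (map f (h x))) xs)
  sum-map-concatMap f h []       = refl
  sum-map-concatMap f h (x ∷ xs) =
    trans (sum-map-++ f (h x) (concatMap h xs)) (cong (_+_ (sum (map f (h x)))) (sum-map-concatMap f h xs))

  sum-map-comm : {B C : Set} (f : B → C → A) (xs : List B) (ys : List C) →
                 sum (map (λ x → sum (map (f x) ys)) xs) ≡ sum (map (λ y → sum (map (λ x → f x y) xs)) ys)
  sum-map-comm f []       ys = sym (sum-map-zero ys (λ _ → refl))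
  sum-map-comm f (x ∷ xs) ys =
    trans (cong (_+_ (sum (map (f x) ys))) (sum-map-comm f xs ys)) (sym (sum-map-+ (f x) _ ys))

  ∑<-suc : ∀ n f → ∑< (suc n) f ≡ f 0 + ∑< n (f ∘ suc)
  ∑<-suc n f = cong (λ ys → f 0 + sum ys)
    (trans (ListP.map-applyUpTo suc f n) (sym (ListP.map-upTo (f ∘ suc) n)))

  ∑<-cong : ∀ n {f g : ℕ → A} → (∀ v → f v ≡ g v) → ∑< n f ≡ ∑< n g
  ∑<-cong n f≡g = cong sum (ListP.map-cong f≡g (upTo n))

  ∑<-cong-< : ∀ n {f g : ℕ → A} → (∀ v → v < n → f v ≡ g v) → ∑< n f ≡ ∑< n g
  ∑<-cong-< zero    f≡g = refl
  ∑<-cong-< (suc n) {f} {g} f≡g = begin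
    ∑< (suc n) f        ≡⟨ ∑<-suc n f ⟩
    f 0 + ∑< n (f ∘ suc) ≡⟨ cong₂ _+_ (f≡g 0 (s≤s z≤n)) (∑<-cong-< n (λ v v<n → f≡g (suc v) (s≤s v<n))) ⟩
    g 0 + ∑< n (g ∘ suc) ≡⟨ sym (∑<-suc n g) ⟩
    ∑< (suc n) g        ∎
    where open ≡-Reasoning

  ∑<-trunc : ∀ {m n} (f : ℕ → A) → m ≤ n → (∀ v → m ≤ v → f v ≡ 0#) → ∑< n f ≡ ∑< m f
  ∑<-trunc {zero}  {n}     f _         f≡0 = sum-map-zero (upTo n) (λ v → f≡0 v z≤n)
  ∑<-trunc {suc m} {suc n} f (s≤s m≤n) f≡0 = begin
    ∑< (suc n) f         ≡⟨ ∑<-suc n f ⟩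
    f 0 + ∑< n (f ∘ suc) ≡⟨ cong (_+_ (f 0)) (∑<-trunc (f ∘ suc) m≤n (λ v m≤v → f≡0 (suc v) (s≤s m≤v))) ⟩
    f 0 + ∑< m (f ∘ suc) ≡⟨ sym (∑<-suc m f) ⟩
    ∑< (suc m) f         ∎
    where open ≡-Reasoning

  ∑<-indicator : ∀ n w a → (n ≤ w → a ≡ 0#) → ∑< n (λ k → if does (w ℕ.≟ k) then a else 0#) ≡ a
  ∑<-indicator zero    w       a n≤w⇒a≡0 = sym (n≤w⇒a≡0 z≤n)
  ∑<-indicator (suc n) zero    a _ = begin
    ∑< (suc n) (λ k → if does (0 ℕ.≟ k) then a else 0#) ≡⟨ ∑<-suc n _ ⟩
    a + ∑< n (λ _ → 0#)                                ≡⟨ cong (_+_ a) (sum-map-zero (upTo n) (λ _ → refl)) ⟩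
    a + 0#                                             ≡⟨ +-identityʳ a ⟩
    a                                                  ∎
    where open ≡-Reasoning
  ∑<-indicator (suc n) (suc w) a n≤w⇒a≡0 = begin
    ∑< (suc n) (λ k → if does (suc w ℕ.≟ k) then a else 0#) ≡⟨ ∑<-suc n _ ⟩
    0# + ∑< n (λ k → if does (w ℕ.≟ k) then a else 0#)       ≡⟨ +-identityˡ _ ⟩
    ∑< n (λ k → if does (w ℕ.≟ k) then a else 0#)            ≡⟨ ∑<-indicator n w a (n≤w⇒a≡0 ∘ s≤s) ⟩
    a                                                      ∎
    where open ≡-Reasoning

open ListSum ℕP.+-*-isCommutativeSemiring hiding (sum)
module ℚSum = ListSum (IsCommutativeRing.isCommutativeSemiring ℚP.+-*-isCommutativeRing)

open CommutativeSemigroupProperties ℕP.+-commutativeSemigroup using () renaming (x∙yz≈y∙xz to +-exchange)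
open CommutativeSemigroupProperties ℕP.*-commutativeSemigroup using ()
  renaming (interchange to *-interchange; x∙yz≈y∙xz to *-exchange)

fallingRec : ℕ → ℕ → ℕ
fallingRec d       zero    = 1
fallingRec zero    (suc k) = 0
fallingRec (suc d) (suc k) = suc d ℕ.* fallingRec d k

fallingRec-suc : ∀ d k → fallingRec d (suc k) ≡ (d ∸ k) ℕ.* fallingRec d k
fallingRec-suc zero    k       = cong (ℕ._* fallingRec 0 k) (sym (ℕP.0∸n≡0 k))
fallingRec-suc (suc d) zero    = refl
fallingRec-suc (suc d) (suc k) =
  trans (cong (suc d ℕ.*_) (fallingRec-suc d k)) (*-exchange (suc d) (d ∸ k) (fallingRec d k))

fallingRec-> : ∀ {d k} → d < k → fallingRec d k ≡ 0
fallingRec-> {zero}  {suc k} _         = refl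
fallingRec-> {suc d} {suc k} (s≤s d<k) = trans (cong (suc d ℕ.*_) (fallingRec-> d<k)) (ℕP.*-zeroʳ (suc d))

P′≡fallingRec : ∀ d k → d P′ k ≡ fallingRec d k
P′≡fallingRec d zero    = refl
P′≡fallingRec d (suc k) = trans (cong ((d ∸ k) ℕ.*_) (P′≡fallingRec d k)) (sym (fallingRec-suc d k))

P≡fallingRec : ∀ d k → d P k ≡ fallingRec d k
P≡fallingRec d k with k ℕP.≤? d
... | yes k≤d with k ℕ.≤ᵇ d | ℕP.≤⇒≤ᵇ k≤d
...   | true | _ = P′≡fallingRec d k
P≡fallingRec d k | no k≰d = trans (k>n⇒nPk≡0 (ℕP.≰⇒> k≰d)) (sym (fallingRec-> (ℕP.≰⇒> k≰d)))

fallingRec-+ : ∀ d v w → fallingRec d (v ℕ.+ w) ≡ fallingRec d v ℕ.* fallingRec (d ∸ v) w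
fallingRec-+ d       zero    w = sym (ℕP.+-identityʳ (fallingRec d w))
fallingRec-+ zero    (suc v) w = refl
fallingRec-+ (suc d) (suc v) w =
  trans (cong (suc d ℕ.*_) (fallingRec-+ d v w)) (sym (ℕP.*-assoc (suc d) (fallingRec d v) _))

P-+ : ∀ d v w → d P (v ℕ.+ w) ≡ (d P v) ℕ.* ((d ∸ v) P w)
P-+ d v w rewrite P≡fallingRec d (v ℕ.+ w) | P≡fallingRec d v | P≡fallingRec (d ∸ v) w =
  fallingRec-+ d v w

C*!≡P : ∀ d k → (d C k) ℕ.* k ! ≡ d P k
C*!≡P d k with k ℕP.≤? d
... | yes k≤d = begin
  (d C k) ℕ.* k !                      ≡⟨ cong (ℕ._* k !) (nCk≡nPk/k! k≤d) ⟩
  ((d P k) / k !) {{k ℕP.!≢0}} ℕ.* k ! ≡⟨ m/n*n≡m {{k ℕP.!≢0}} k!∣dPk ⟩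
  d P k                                ∎
  where
  open ≡-Reasoning
  k!∣dPk : k ! ∣ (d P k)
  k!∣dPk with k ℕ.≤ᵇ d | ℕP.≤⇒≤ᵇ k≤d
  ... | true | _ = k!∣nP′k k≤d
... | no k≰d = trans (cong (ℕ._* k !) (k>n⇒nCk≡0 (ℕP.≰⇒> k≰d))) (sym (k>n⇒nPk≡0 (ℕP.≰⇒> k≰d)))

toℚᵘ-/ : ∀ a b .{{_ : NonZero b}} → toℚᵘ (+ a ℚ./ b) ≃ mkℚᵘ (+ a) (ℕ.pred b)
toℚᵘ-/ a (suc b) = ℚP.toℚᵘ-fromℚᵘ (mkℚᵘ (+ a) b)

ℕtoℚ-+ : ∀ a b → ℕtoℚ (a ℕ.+ b) ≡ ℕtoℚ a ℚ.+ ℕtoℚ b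
ℕtoℚ-+ a b = ℚP.toℚᵘ-injective (ℚᵘP.≃-trans (toℚᵘ-/ (a ℕ.+ b) 1) (ℚᵘP.≃-sym
  (ℚᵘP.≃-trans (ℚP.toℚᵘ-homo-+ (ℕtoℚ a) (ℕtoℚ b))
  (ℚᵘP.≃-trans (ℚᵘP.+-cong (toℚᵘ-/ a 1) (toℚᵘ-/ b 1)) (*≡* (eq (+ a) (+ b)))))))
  where
  eq : ∀ x y → (x ℤ.* + 1 ℤ.+ y ℤ.* + 1) ℤ.* + 1 ≡ (x ℤ.+ y) ℤ.* + 1
  eq = solve-∀

ℕtoℚ-sum : ∀ {B : Set} (f : B → ℕ) xs → sumℚ (map (ℕtoℚ ∘ f) xs) ≡ ℕtoℚ (sumℕ (map f xs))
ℕtoℚ-sum f []       = refl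
ℕtoℚ-sum f (x ∷ xs) = trans (cong (ℕtoℚ (f x) ℚ.+_) (ℕtoℚ-sum f xs)) (sym (ℕtoℚ-+ (f x) _))

ℕtoℚ-*-/ : ∀ a b .{{_ : NonZero b}} → ℕtoℚ (a ℕ.* b) ℚ.* (+ 1 ℚ./ b) ≡ ℕtoℚ a
ℕtoℚ-*-/ a b@(suc _) = ℚP.toℚᵘ-injective
  (ℚᵘP.≃-trans (ℚP.toℚᵘ-homo-* (ℕtoℚ (a ℕ.* b)) (+ 1 ℚ./ b))
  (ℚᵘP.≃-trans (ℚᵘP.*-cong (toℚᵘ-/ (a ℕ.* b) 1) (toℚᵘ-/ 1 b))
  (ℚᵘP.≃-trans (*≡* eq) (ℚᵘP.≃-sym (toℚᵘ-/ a 1)))))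
  where
  *1*1 : ∀ x → x ℤ.* + 1 ℤ.* + 1 ≡ x
  *1*1 = solve-∀
  eq : (+ (a ℕ.* b) ℤ.* + 1) ℤ.* + 1 ≡ + a ℤ.* + (1 ℕ.* b)
  eq = trans (*1*1 (+ (a ℕ.* b)))
     (trans (cong (λ n → + (a ℕ.* n)) (sym (ℕP.*-identityˡ b))) (ℤP.pos-* a (1 ℕ.* b)))

+≡⇒≡- : ∀ {a c x : ℤ} → a ℤ.+ c ≡ x → c ≡ x ℤ.- a
+≡⇒≡- {a} {c} refl = cancel a c
  where
  cancel : ∀ a c → c ≡ a ℤ.+ c ℤ.- a
  cancel = solve-∀

≡-⇒+≡ : ∀ {a c x : ℤ} → c ≡ x ℤ.- a → a ℤ.+ c ≡ x
≡-⇒+≡ {a} {x = x} refl = cancel a x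
  where
  cancel : ∀ a x → a ℤ.+ (x ℤ.- a) ≡ x
  cancel = solve-∀

module _ {r : ℕ} where

  totalSumOn : List (Subset r) → Tuple r → ℕ
  totalSumOn Us s = sumℕ (map s Us)

  coverSumOn : List (Subset r) → Tuple r → Fin r → ℕ
  coverSumOn Us s i = sumℕ (map s (filter (i ∈?_) Us))

  factProdOn : List (Subset r) → Tuple r → ℕ
  factProdOn Us s = productℕ (map (λ U → s U !) Us)

  Covers : List (Subset r) → (Fin r → ℤ) → Tuple r → Set
  Covers Us ν s = ∀ i → + coverSumOn Us s i ≡ ν i

  covers? : ∀ Us ν s → Dec (Covers Us ν s)
  covers? Us ν s = all? (λ i → + coverSumOn Us s i ℤP.≟ ν i)

  multinomial : ℕ → List (Subset r) → Tuple r → ℕ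
  multinomial d []       s = 1
  multinomial d (U ∷ Us) s = (d C s U) ℕ.* multinomial (d ∸ s U) Us s

  multinomial*factProdOn≡P : ∀ d Us s → multinomial d Us s ℕ.* factProdOn Us s ≡ d P totalSumOn Us s
  multinomial*factProdOn≡P d []       s = refl
  multinomial*factProdOn≡P d (U ∷ Us) s = begin
    (d C s U) ℕ.* m ℕ.* (s U ! ℕ.* f)   ≡⟨ *-interchange (d C s U) m (s U !) f ⟩
    (d C s U) ℕ.* s U ! ℕ.* (m ℕ.* f)  ≡⟨ cong₂ ℕ._*_ (C*!≡P d (s U)) (multinomial*factProdOn≡P (d ∸ s U) Us s) ⟩
    (d P s U) ℕ.* ((d ∸ s U) P w)       ≡⟨ sym (P-+ d (s U) w) ⟩
    d P (s U ℕ.+ w)                     ∎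
    where
    open ≡-Reasoning
    m = multinomial (d ∸ s U) Us s
    f = factProdOn Us s
    w = totalSumOn Us s

  multinomial-vanish : ∀ {d} Us s → d < totalSumOn Us s → multinomial d Us s ≡ 0
  multinomial-vanish {d} Us s d<w = ℕP.m*n≡0⇒m≡0 _ _ {{factProdList≢0 s Us}}
    (trans (multinomial*factProdOn≡P d Us s) (k>n⇒nPk≡0 d<w))

  AgreeOn : List (Subset r) → Tuple r → Tuple r → Set
  AgreeOn Us s t = All (λ U → s U ≡ t U) Us

  totalSumOn-cong : ∀ {Us s t} → AgreeOn Us s t → totalSumOn Us s ≡ totalSumOn Us t
  totalSumOn-cong s≡t = cong sumℕ (ListP.map-cong-local s≡t)

  coverSumOn-cong : ∀ {Us s t} → AgreeOn Us s t → ∀ i → coverSumOn Us s i ≡ coverSumOn Us t i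
  coverSumOn-cong s≡t i = cong sumℕ (ListP.map-cong-local (AllP.filter⁺ (i ∈?_) s≡t))

  multinomial-cong : ∀ {Us s t} d → AgreeOn Us s t → multinomial d Us s ≡ multinomial d Us t
  multinomial-cong d []                            = refl
  multinomial-cong {U ∷ _} {t = t} d (sU≡tU ∷ s≡t) rewrite sU≡tU =
    cong ((d C t U) ℕ.*_) (multinomial-cong (d ∸ t U) s≡t)

  update-self : ∀ U v (t : Tuple r) → update U v t U ≡ v
  update-self U v t rewrite dec-true (VecP.≡-dec BoolP._≟_ U U) refl = refl

  update-agree : ∀ {U Us} v (t : Tuple r) → All (U ≢_) Us → AgreeOn Us (update U v t) t
  update-agree {U} v t = All.map update-other
    where
    update-other : ∀ {W} → U ≢ W → update U v t W ≡ t W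
    update-other {W} U≢W rewrite dec-false (VecP.≡-dec BoolP._≟_ W U) (U≢W ∘ sym) = refl

  totalSumOn-update : ∀ {U Us} v t → All (U ≢_) Us → totalSumOn (U ∷ Us) (update U v t) ≡ v ℕ.+ totalSumOn Us t
  totalSumOn-update {U} v t U∉Us = cong₂ ℕ._+_ (update-self U v t) (totalSumOn-cong (update-agree v t U∉Us))

  coverBy : Subset r → ℕ → Fin r → ℕ
  coverBy U v i = if does (i ∈? U) then v else 0

  lower : Subset r → ℕ → (Fin r → ℤ) → Fin r → ℤ
  lower U v ν i = ν i ℤ.- + coverBy U v i

  coverSumOn-∷ : ∀ U Us s i → coverSumOn (U ∷ Us) s i ≡ coverBy U (s U) i ℕ.+ coverSumOn Us s i
  coverSumOn-∷ U Us s i with does (i ∈? U)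
  ... | true  = refl
  ... | false = refl

  covers-update : ∀ {U Us} v t ν → All (U ≢_) Us →
    does (covers? (U ∷ Us) ν (update U v t)) ≡ does (covers? Us (lower U v ν) t)
  covers-update {U} {Us} v t ν U∉Us = does-⇔ (mk⇔ to from) (covers? (U ∷ Us) ν (update U v t)) (covers? Us (lower U v ν) t)
    where
    cover-eq : ∀ i → coverSumOn (U ∷ Us) (update U v t) i ≡ coverBy U v i ℕ.+ coverSumOn Us t i
    cover-eq i = trans (coverSumOn-∷ U Us (update U v t) i)
      (cong₂ (λ a b → coverBy U a i ℕ.+ b) (update-self U v t) (coverSumOn-cong (update-agree v t U∉Us) i))
    to : Covers (U ∷ Us) ν (update U v t) → Covers Us (lower U v ν) t
    to c i = +≡⇒≡- (trans (cong +_ (sym (cover-eq i))) (c i))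
    from : Covers Us (lower U v ν) t → Covers (U ∷ Us) ν (update U v t)
    from c i = trans (cong +_ (cover-eq i)) (≡-⇒+≡ (c i))

  weight : List (Subset r) → ℕ → (Fin r → ℤ) → Tuple r → ℕ
  weight Us d ν s = if does (covers? Us ν s) then multinomial d Us s else 0

  weight-update : ∀ {U Us} d ν v t → All (U ≢_) Us →
    weight (U ∷ Us) d ν (update U v t) ≡ (d C v) ℕ.* weight Us (d ∸ v) (lower U v ν) t
  weight-update {U} {Us} d ν v t U∉Us
    rewrite covers-update v t ν U∉Us | update-self U v t | multinomial-cong (d ∸ v) (update-agree v t U∉Us)
    with does (covers? Us (lower U v ν) t)
  ... | true  = refl
  ... | false = sym (ℕP.*-zeroʳ (d C v))

  weightSum : List (Subset r) → ℕ → ℕ → (Fin r → ℤ) → ℕ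
  weightSum Us B d ν = sumℕ (map (weight Us d ν) (assignments Us B))

  sum-assignments-∷ : ∀ (f : Tuple r → ℕ) U Us B →
    sumℕ (map f (assignments (U ∷ Us) B)) ≡ ∑< (suc B) (λ v → sumℕ (map (f ∘ update U v) (assignments Us B)))
  sum-assignments-∷ f U Us B =
    trans (sum-map-concatMap f (λ v → map (update U v) (assignments Us B)) (upTo (suc B)))
          (∑<-cong (suc B) (λ v → cong sumℕ (sym (ListP.map-∘ (assignments Us B)))))

  sum-assignments-extend : ∀ {Us} → Unique Us → ∀ {m K} (f : Tuple r → ℕ) → m ≤ K →
    (∀ s → m < totalSumOn Us s → f s ≡ 0) →
    sumℕ (map f (assignments Us K)) ≡ sumℕ (map f (assignments Us m))
  sum-assignments-extend []                       f m≤K f≡0 = refl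
  sum-assignments-extend {U ∷ Us} (U∉Us ∷ unique) {m} {K} f m≤K f≡0 = begin
    sumℕ (map f (assignments (U ∷ Us) K)) ≡⟨ sum-assignments-∷ f U Us K ⟩
    ∑< (suc K) (slice K)                  ≡⟨ ∑<-cong (suc K) slice-K≡m ⟩
    ∑< (suc K) (slice m)                  ≡⟨ ∑<-trunc (slice m) (s≤s m≤K) (slice-vanish m) ⟩
    ∑< (suc m) (slice m)                  ≡⟨ sym (sum-assignments-∷ f U Us m) ⟩
    sumℕ (map f (assignments (U ∷ Us) m)) ∎
    where
    open ≡-Reasoning
    slice : ℕ → ℕ → ℕ
    slice B v = sumℕ (map (f ∘ update U v) (assignments Us B))
    f-update≡0 : ∀ v t → m < v ℕ.+ totalSumOn Us t → f (update U v t) ≡ 0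
    f-update≡0 v t m<v+w = f≡0 (update U v t) (subst (m <_) (sym (totalSumOn-update v t U∉Us)) m<v+w)
    slice-vanish : ∀ B v → m < v → slice B v ≡ 0
    slice-vanish B v m<v =
      sum-map-zero (assignments Us B) (λ t → f-update≡0 v t (ℕP.<-≤-trans m<v (ℕP.m≤m+n v _)))
    slice-K≡m : ∀ v → slice K v ≡ slice m v
    slice-K≡m v = sum-assignments-extend unique (f ∘ update U v) m≤K
      (λ t m<w → f-update≡0 v t (ℕP.<-≤-trans m<w (ℕP.m≤n+m _ v)))

  zero? : (ν : Fin r → ℤ) → Dec (∀ i → + 0 ≡ ν i)
  zero? ν = all? (λ i → + 0 ℤP.≟ ν i)

  -- The number of ways to send d labelled points to the blocks Us or to a spare block
  -- so that exactly ν i points land in blocks containing i.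
  distributions : List (Subset r) → ℕ → (Fin r → ℤ) → ℕ
  distributions []       d ν = if does (zero? ν) then 1 else 0
  distributions (U ∷ Us) d ν = ∑< (suc d) (λ v → (d C v) ℕ.* distributions Us (d ∸ v) (lower U v ν))

  weightSum≡distributions : ∀ {Us} → Unique Us → ∀ {d B} ν → d ≤ B → weightSum Us B d ν ≡ distributions Us d ν
  weightSum≡distributions []                   ν _ = ℕP.+-identityʳ _
  weightSum≡distributions {U ∷ Us} (U∉Us ∷ unique) {d} {B} ν d≤B = begin
    weightSum (U ∷ Us) B d ν
      ≡⟨ sum-assignments-∷ (weight (U ∷ Us) d ν) U Us B ⟩
    ∑< (suc B) (λ v → sumℕ (map (weight (U ∷ Us) d ν ∘ update U v) (assignments Us B)))
      ≡⟨ ∑<-cong (suc B) slice≡ ⟩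
    ∑< (suc B) (λ v → (d C v) ℕ.* distributions Us (d ∸ v) (lower U v ν))
      ≡⟨ ∑<-trunc _ (s≤s d≤B) (λ v d<v → cong (ℕ._* distributions Us (d ∸ v) (lower U v ν)) (k>n⇒nCk≡0 d<v)) ⟩
    distributions (U ∷ Us) d ν ∎
    where
    open ≡-Reasoning
    slice≡ : ∀ v → sumℕ (map (weight (U ∷ Us) d ν ∘ update U v) (assignments Us B))
                 ≡ (d C v) ℕ.* distributions Us (d ∸ v) (lower U v ν)
    slice≡ v = begin
      sumℕ (map (weight (U ∷ Us) d ν ∘ update U v) (assignments Us B))
        ≡⟨ cong sumℕ (ListP.map-cong (λ t → weight-update d ν v t U∉Us) (assignments Us B)) ⟩
      sumℕ (map (λ t → (d C v) ℕ.* weight Us (d ∸ v) (lower U v ν) t) (assignments Us B))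
        ≡⟨ sym (*-distribˡ-sum-map (d C v) _ (assignments Us B)) ⟩
      (d C v) ℕ.* weightSum Us B (d ∸ v) (lower U v ν)
        ≡⟨ cong ((d C v) ℕ.*_) (weightSum≡distributions unique (lower U v ν) (ℕP.≤-trans (ℕP.m∸n≤m d v) d≤B)) ⟩
      (d C v) ℕ.* distributions Us (d ∸ v) (lower U v ν) ∎

∑<-pascal : ∀ d (g : ℕ → ℕ) →
  ∑< (suc (suc d)) (λ v → (suc d C v) ℕ.* g v)
  ≡ ∑< (suc d) (λ v → (d C v) ℕ.* g (suc v)) ℕ.+ ∑< (suc d) (λ v → (d C v) ℕ.* g v)
∑<-pascal d g = begin
  ∑< (suc (suc d)) (λ v → (suc d C v) ℕ.* g v)
    ≡⟨ ∑<-suc (suc d) (λ v → (suc d C v) ℕ.* g v) ⟩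
  g₀ ℕ.+ ∑< (suc d) (λ v → (suc d C suc v) ℕ.* g (suc v))
    ≡⟨ cong (g₀ ℕ.+_) (∑<-cong (suc d) pascal) ⟩
  g₀ ℕ.+ ∑< (suc d) (λ v → (d C v) ℕ.* g (suc v) ℕ.+ (d C suc v) ℕ.* g (suc v))
    ≡⟨ cong (g₀ ℕ.+_) (sum-map-+ (λ v → (d C v) ℕ.* g (suc v)) (λ v → (d C suc v) ℕ.* g (suc v)) (upTo (suc d))) ⟩
  g₀ ℕ.+ (shifted ℕ.+ ∑< (suc d) (λ v → (d C suc v) ℕ.* g (suc v)))
    ≡⟨ +-exchange g₀ shifted _ ⟩
  shifted ℕ.+ (g₀ ℕ.+ ∑< (suc d) (λ v → (d C suc v) ℕ.* g (suc v)))
    ≡⟨ cong (shifted ℕ.+_) (sym (∑<-suc (suc d) (λ v → (d C v) ℕ.* g v))) ⟩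
  shifted ℕ.+ ∑< (suc (suc d)) (λ v → (d C v) ℕ.* g v)
    ≡⟨ cong (shifted ℕ.+_) (∑<-trunc _ (ℕP.n≤1+n (suc d)) (λ v d<v → cong (ℕ._* g v) (k>n⇒nCk≡0 d<v))) ⟩
  shifted ℕ.+ ∑< (suc d) (λ v → (d C v) ℕ.* g v) ∎
  where
  open ≡-Reasoning
  g₀ = (d C 0) ℕ.* g 0
  shifted = ∑< (suc d) (λ v → (d C v) ℕ.* g (suc v))
  pascal : ∀ v → (suc d C suc v) ℕ.* g (suc v) ≡ (d C v) ℕ.* g (suc v) ℕ.+ (d C suc v) ℕ.* g (suc v)
  pascal v = trans (cong (ℕ._* g (suc v)) (sym (nCk+nC[k+1]≡[n+1]C[k+1] d v)))
                   (ℕP.*-distribʳ-+ (g (suc v)) (d C v) (d C suc v))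

module _ {r : ℕ} where

  lower-cong : ∀ U v {ν μ : Fin r → ℤ} → ν ≗ μ → lower U v ν ≗ lower U v μ
  lower-cong U v ν≗μ i = cong (ℤ._- + coverBy U v i) (ν≗μ i)

  lower-zero : ∀ U (ν : Fin r → ℤ) → lower U 0 ν ≗ ν
  lower-zero U ν i with does (i ∈? U)
  ... | true  = ℤP.+-identityʳ (ν i)
  ... | false = ℤP.+-identityʳ (ν i)

  lower-lower : ∀ U a b (ν : Fin r → ℤ) → lower U b (lower U a ν) ≗ lower U (a ℕ.+ b) ν
  lower-lower U a b ν i = trans (sub-sub (ν i) _ _) (cong (λ c → ν i ℤ.- + c) coverBy-+)
    where
    sub-sub : ∀ x p q → x ℤ.- p ℤ.- q ≡ x ℤ.- (p ℤ.+ q)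
    sub-sub = solve-∀
    coverBy-+ : coverBy U a i ℕ.+ coverBy U b i ≡ coverBy U (a ℕ.+ b) i
    coverBy-+ with does (i ∈? U)
    ... | true  = refl
    ... | false = refl

  lower-comm : ∀ U W a b (ν : Fin r → ℤ) → lower U a (lower W b ν) ≗ lower W b (lower U a ν)
  lower-comm U W a b ν i = sub-comm (ν i) _ _
    where
    sub-comm : ∀ x p q → x ℤ.- p ℤ.- q ≡ x ℤ.- q ℤ.- p
    sub-comm = solve-∀

  distributions-cong : ∀ Us d {ν μ : Fin r → ℤ} → ν ≗ μ → distributions Us d ν ≡ distributions Us d μ
  distributions-cong []       d {ν} {μ} ν≗μ = cong (λ b → if b then 1 else 0)
    (does-⇔ (mk⇔ (λ ν≡0 i → trans (ν≡0 i) (ν≗μ i)) (λ μ≡0 i → trans (μ≡0 i) (sym (ν≗μ i)))) (zero? ν) (zero? μ))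
  distributions-cong (U ∷ Us) d ν≗μ = ∑<-cong (suc d) (λ v →
    cong ((d C v) ℕ.*_) (distributions-cong Us (d ∸ v) (lower-cong U v ν≗μ)))

  distributions-zero : ∀ Us (ν : Fin r → ℤ) → distributions Us 0 ν ≡ distributions [] 0 ν
  distributions-zero []       ν = refl
  distributions-zero (U ∷ Us) ν =
    trans (ℕP.+-identityʳ _) (trans (ℕP.+-identityʳ _)
      (trans (distributions-zero Us (lower U 0 ν)) (distributions-cong [] 0 (lower-zero U ν))))

  distributions-suc : ∀ Us d (ν : Fin r → ℤ) →
    distributions Us (suc d) ν ≡ distributions Us d ν ℕ.+ sumℕ (map (λ W → distributions Us d (lower W 1 ν)) Us)
  distributions-suc []       d ν = sym (ℕP.+-identityʳ _)
  distributions-suc (U ∷ Us) d ν = begin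
    distributions (U ∷ Us) (suc d) ν
      ≡⟨ ∑<-pascal d (λ v → distributions Us (suc d ∸ v) (lower U v ν)) ⟩
    ∑< (suc d) (λ v → (d C v) ℕ.* distributions Us (d ∸ v) (lower U (suc v) ν))
      ℕ.+ ∑< (suc d) (λ v → (d C v) ℕ.* distributions Us (suc d ∸ v) (lower U v ν))
      ≡⟨ cong₂ ℕ._+_ lowered-by-U unlowered ⟩
    distributions (U ∷ Us) d (lower U 1 ν) ℕ.+ (distributions (U ∷ Us) d ν ℕ.+ lowered-by-Us)
      ≡⟨ +-exchange (distributions (U ∷ Us) d (lower U 1 ν)) (distributions (U ∷ Us) d ν) lowered-by-Us ⟩
    distributions (U ∷ Us) d ν ℕ.+ (distributions (U ∷ Us) d (lower U 1 ν) ℕ.+ lowered-by-Us) ∎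
    where
    open ≡-Reasoning
    lowered-by-Us = sumℕ (map (λ W → distributions (U ∷ Us) d (lower W 1 ν)) Us)
    lowered-by-U : ∑< (suc d) (λ v → (d C v) ℕ.* distributions Us (d ∸ v) (lower U (suc v) ν))
                   ≡ distributions (U ∷ Us) d (lower U 1 ν)
    lowered-by-U = ∑<-cong (suc d) (λ v → cong ((d C v) ℕ.*_)
      (distributions-cong Us (d ∸ v) (λ i → sym (lower-lower U 1 v ν i))))
    S : ℕ → ℕ
    S v = sumℕ (map (λ W → distributions Us (d ∸ v) (lower W 1 (lower U v ν))) Us)
    swapped : ∑< (suc d) (λ v → (d C v) ℕ.* S v) ≡ lowered-by-Us
    swapped = begin
      ∑< (suc d) (λ v → (d C v) ℕ.* S v)
        ≡⟨ ∑<-cong (suc d) (λ v → *-distribˡ-sum-map (d C v) _ Us) ⟩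
      ∑< (suc d) (λ v → sumℕ (map (λ W → (d C v) ℕ.* distributions Us (d ∸ v) (lower W 1 (lower U v ν))) Us))
        ≡⟨ sum-map-comm (λ v W → (d C v) ℕ.* distributions Us (d ∸ v) (lower W 1 (lower U v ν))) (upTo (suc d)) Us ⟩
      sumℕ (map (λ W → ∑< (suc d) (λ v → (d C v) ℕ.* distributions Us (d ∸ v) (lower W 1 (lower U v ν)))) Us)
        ≡⟨ cong sumℕ (ListP.map-cong (λ W → ∑<-cong (suc d) (λ v → cong ((d C v) ℕ.*_)
             (distributions-cong Us (d ∸ v) (lower-comm W U 1 v ν)))) Us) ⟩
      lowered-by-Us ∎
    unlowered : ∑< (suc d) (λ v → (d C v) ℕ.* distributions Us (suc d ∸ v) (lower U v ν))
                ≡ distributions (U ∷ Us) d ν ℕ.+ lowered-by-Us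
    unlowered = begin
      ∑< (suc d) (λ v → (d C v) ℕ.* distributions Us (suc d ∸ v) (lower U v ν))
        ≡⟨ ∑<-cong-< (suc d) (λ v v<1+d → cong (λ n → (d C v) ℕ.* distributions Us n (lower U v ν))
             (ℕP.+-∸-assoc 1 (ℕP.≤-pred v<1+d))) ⟩
      ∑< (suc d) (λ v → (d C v) ℕ.* distributions Us (suc (d ∸ v)) (lower U v ν))
        ≡⟨ ∑<-cong (suc d) (λ v → trans (cong ((d C v) ℕ.*_) (distributions-suc Us (d ∸ v) (lower U v ν)))
             (ℕP.*-distribˡ-+ (d C v) _ (S v))) ⟩
      ∑< (suc d) (λ v → (d C v) ℕ.* distributions Us (d ∸ v) (lower U v ν) ℕ.+ (d C v) ℕ.* S v)
        ≡⟨ sum-map-+ (λ v → (d C v) ℕ.* distributions Us (d ∸ v) (lower U v ν)) (λ v → (d C v) ℕ.* S v) (upTo (suc d)) ⟩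
      distributions (U ∷ Us) d ν ℕ.+ ∑< (suc d) (λ v → (d C v) ℕ.* S v)
        ≡⟨ cong (distributions (U ∷ Us) d ν ℕ.+_) swapped ⟩
      distributions (U ∷ Us) d ν ℕ.+ lowered-by-Us ∎

filter-nonempty-inside : ∀ {r} (Ws : List (Subset r)) → filter nonempty? (map (inside ∷_) Ws) ≡ map (inside ∷_) Ws
filter-nonempty-inside []       = refl
filter-nonempty-inside (W ∷ Ws) =
  trans (ListP.filter-accept nonempty? {xs = map (inside ∷_) Ws} (fzero , _[_]=_.here)) (cong ((inside ∷ W) ∷_) (filter-nonempty-inside Ws))

filter-nonempty-outside : ∀ {r} (Ws : List (Subset r)) →
  filter nonempty? (map (outside ∷_) Ws) ≡ map (outside ∷_) (filter nonempty? Ws)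
filter-nonempty-outside []       = refl
filter-nonempty-outside (W ∷ Ws) with nonempty? W
... | yes (i , i∈W) =
  trans (ListP.filter-accept nonempty? {xs = map (outside ∷_) Ws} (fsuc i , _[_]=_.there i∈W)) (cong ((outside ∷ W) ∷_) (filter-nonempty-outside Ws))
... | no  W-empty   =
  trans (ListP.filter-reject nonempty? {x = outside ∷ W} {xs = map (outside ∷_) Ws} λ { (fsuc i , _[_]=_.there i∈W) → W-empty (i , i∈W) }) (filter-nonempty-outside Ws)

nonemptySubsets-suc : ∀ r →
  nonemptySubsets (suc r) ≡ map (outside ∷_) (nonemptySubsets r) ++ map (inside ∷_) (allSubsets r)
nonemptySubsets-suc r =
  trans (ListP.filter-++ nonempty? (map (outside ∷_) (allSubsets r)) (map (inside ∷_) (allSubsets r)))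
        (cong₂ _++_ (filter-nonempty-outside (allSubsets r)) (filter-nonempty-inside (allSubsets r)))

sum-map-outside-inside : ∀ {r} (f : Subset (suc r) → ℕ) Ws Vs →
  sumℕ (map f (map (outside ∷_) Ws ++ map (inside ∷_) Vs))
  ≡ sumℕ (map (f ∘ (outside ∷_)) Ws) ℕ.+ sumℕ (map (f ∘ (inside ∷_)) Vs)
sum-map-outside-inside f Ws Vs =
  trans (sum-map-++ f (map (outside ∷_) Ws) (map (inside ∷_) Vs))
        (cong₂ ℕ._+_ (cong sumℕ (sym (ListP.map-∘ Ws))) (cong sumℕ (sym (ListP.map-∘ Vs))))

sum-allSubsets : ∀ r (f : Subset r → ℕ) →
  sumℕ (map f (allSubsets r)) ≡ f ⊥ ℕ.+ sumℕ (map f (nonemptySubsets r))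
sum-allSubsets zero    f = refl
sum-allSubsets (suc r) f = begin
  sumℕ (map f (allSubsets (suc r)))
    ≡⟨ sum-map-outside-inside f (allSubsets r) (allSubsets r) ⟩
  sumℕ (map (f ∘ (outside ∷_)) (allSubsets r)) ℕ.+ sumℕ (map (f ∘ (inside ∷_)) (allSubsets r))
    ≡⟨ cong (ℕ._+ sumℕ (map (f ∘ (inside ∷_)) (allSubsets r))) (sum-allSubsets r (f ∘ (outside ∷_))) ⟩
  f ⊥ ℕ.+ sumℕ (map (f ∘ (outside ∷_)) (nonemptySubsets r)) ℕ.+ sumℕ (map (f ∘ (inside ∷_)) (allSubsets r))
    ≡⟨ ℕP.+-assoc (f ⊥) _ _ ⟩
  f ⊥ ℕ.+ (sumℕ (map (f ∘ (outside ∷_)) (nonemptySubsets r)) ℕ.+ sumℕ (map (f ∘ (inside ∷_)) (allSubsets r)))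
    ≡⟨ cong (f ⊥ ℕ.+_) (sym (sum-map-outside-inside f (nonemptySubsets r) (allSubsets r))) ⟩
  f ⊥ ℕ.+ sumℕ (map f (map (outside ∷_) (nonemptySubsets r) ++ map (inside ∷_) (allSubsets r)))
    ≡⟨ cong (λ Ws → f ⊥ ℕ.+ sumℕ (map f Ws)) (sym (nonemptySubsets-suc r)) ⟩
  f ⊥ ℕ.+ sumℕ (map f (nonemptySubsets (suc r))) ∎
  where open ≡-Reasoning

map-allFin-suc : ∀ {B : Set} r (h : Fin (suc r) → B) → map h (allFin (suc r)) ≡ h fzero ∷ map (h ∘ fsuc) (allFin r)
map-allFin-suc r h = cong (h fzero ∷_) (trans (ListP.map-tabulate fsuc h) (sym (ListP.map-tabulate (λ i → i) (h ∘ fsuc))))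

sum-allSubsets-∏ : ∀ r (g : Fin r → Bool → ℕ) →
  sumℕ (map (λ W → productℕ (map (λ i → g i (does (i ∈? W))) (allFin r))) (allSubsets r))
  ≡ productℕ (map (λ i → g i false ℕ.+ g i true) (allFin r))
sum-allSubsets-∏ zero    g = refl
sum-allSubsets-∏ (suc r) g = begin
  sumℕ (map ∏ (allSubsets (suc r)))
    ≡⟨ sum-map-outside-inside ∏ (allSubsets r) (allSubsets r) ⟩
  sumℕ (map (∏ ∘ (outside ∷_)) (allSubsets r)) ℕ.+ sumℕ (map (∏ ∘ (inside ∷_)) (allSubsets r))
    ≡⟨ cong₂ ℕ._+_ (∏-∷-sum outside) (∏-∷-sum inside) ⟩
  g fzero false ℕ.* sumℕ (map ∏′ (allSubsets r)) ℕ.+ g fzero true ℕ.* sumℕ (map ∏′ (allSubsets r))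
    ≡⟨ sym (ℕP.*-distribʳ-+ _ (g fzero false) (g fzero true)) ⟩
  (g fzero false ℕ.+ g fzero true) ℕ.* sumℕ (map ∏′ (allSubsets r))
    ≡⟨ cong ((g fzero false ℕ.+ g fzero true) ℕ.*_) (sum-allSubsets-∏ r (g ∘ fsuc)) ⟩
  (g fzero false ℕ.+ g fzero true) ℕ.* productℕ (map (λ i → g (fsuc i) false ℕ.+ g (fsuc i) true) (allFin r))
    ≡⟨ cong productℕ (sym (map-allFin-suc r (λ i → g i false ℕ.+ g i true))) ⟩
  productℕ (map (λ i → g i false ℕ.+ g i true) (allFin (suc r))) ∎
  where
  open ≡-Reasoning
  ∏ : Subset (suc r) → ℕ
  ∏ W = productℕ (map (λ i → g i (does (i ∈? W))) (allFin (suc r)))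
  ∏′ : Subset r → ℕ
  ∏′ W = productℕ (map (λ i → g (fsuc i) (does (i ∈? W))) (allFin r))
  ∏-∷ : ∀ b W → ∏ (b ∷ W) ≡ g fzero b ℕ.* ∏′ W
  ∏-∷ outside W = cong productℕ (map-allFin-suc r (λ i → g i (does (i ∈? (outside ∷ W)))))
  ∏-∷ inside  W = cong productℕ (map-allFin-suc r (λ i → g i (does (i ∈? (inside ∷ W)))))
  ∏-∷-sum : ∀ b → sumℕ (map (∏ ∘ (b ∷_)) (allSubsets r)) ≡ g fzero b ℕ.* sumℕ (map ∏′ (allSubsets r))
  ∏-∷-sum b = trans (cong sumℕ (ListP.map-cong (∏-∷ b) (allSubsets r)))
                    (sym (*-distribˡ-sum-map (g fzero b) ∏′ (allSubsets r)))

binomℤ-pascal : ∀ d x → binomℤ d (x ℤ.- + 0) ℕ.+ binomℤ d (x ℤ.- + 1) ≡ binomℤ (suc d) x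
binomℤ-pascal d (+ zero)  = ℕP.+-identityʳ (d C 0)
binomℤ-pascal d (+ suc n) rewrite ℕP.+-identityʳ n =
  trans (ℕP.+-comm (d C suc n) (d C n)) (nCk+nC[k+1]≡[n+1]C[k+1] d n)
binomℤ-pascal d -[1+ n ]  = refl

product-map-one : ∀ {B : Set} (f : B → ℕ) xs → (∀ x → f x ≡ 1) → productℕ (map f xs) ≡ 1
product-map-one f []       f≡1 = refl
product-map-one f (x ∷ xs) f≡1 rewrite f≡1 x | product-map-one f xs f≡1 = refl

product-map-zero : ∀ {B : Set} (f : B → ℕ) {xs x} → x ∈ xs → f x ≡ 0 → productℕ (map f xs) ≡ 0
product-map-zero f (here refl) fx≡0 rewrite fx≡0 = refl
product-map-zero f {y ∷ _} (there x∈xs) fx≡0 rewrite product-map-zero f x∈xs fx≡0 = ℕP.*-zeroʳ (f y)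

binomℤ-0 : ∀ x → x ≢ + 0 → binomℤ 0 x ≡ 0
binomℤ-0 (+ zero)  x≢0 = ⊥-elim (x≢0 refl)
binomℤ-0 (+ suc n) _   = refl
binomℤ-0 -[1+ n ]  _   = refl

distributions-[]≡∏binom0 : ∀ {r} (ν : Fin r → ℤ) →
  distributions [] 0 ν ≡ productℕ (map (λ i → binomℤ 0 (ν i)) (allFin r))
distributions-[]≡∏binom0 {r} ν = indicator≡∏ (zero? ν)
  where
  indicator≡∏ : (ν≡0? : Dec (∀ i → + 0 ≡ ν i)) →
                (if does ν≡0? then 1 else 0) ≡ productℕ (map (λ i → binomℤ 0 (ν i)) (allFin r))
  indicator≡∏ (yes ν≡0) = sym (product-map-one _ (allFin r) (λ i → subst (λ x → binomℤ 0 x ≡ 1) (ν≡0 i) refl))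
  indicator≡∏ (no  ν≢0) with ¬∀⟶∃¬ r _ (λ i → + 0 ℤP.≟ ν i) ν≢0
  ... | i , νi≢0 = sym (product-map-zero _ (∈-allFin i) (binomℤ-0 (ν i) (νi≢0 ∘ sym)))

distributions-nonempty≡∏binom : ∀ {r} d (ν : Fin r → ℤ) →
  distributions (nonemptySubsets r) d ν ≡ productℕ (map (λ i → binomℤ d (ν i)) (allFin r))
distributions-nonempty≡∏binom {r} zero    ν =
  trans (distributions-zero (nonemptySubsets r) ν) (distributions-[]≡∏binom0 ν)
distributions-nonempty≡∏binom {r} (suc d) ν = begin
  distributions Us (suc d) ν
    ≡⟨ distributions-suc Us d ν ⟩
  distributions Us d ν ℕ.+ sumℕ (map lowered Us)
    ≡⟨ cong (ℕ._+ sumℕ (map lowered Us)) (distributions-cong Us d ν≗lower⊥) ⟩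
  lowered ⊥ ℕ.+ sumℕ (map lowered Us)
    ≡⟨ sym (sum-allSubsets r lowered) ⟩
  sumℕ (map lowered (allSubsets r))
    ≡⟨ cong sumℕ (ListP.map-cong (λ W → distributions-nonempty≡∏binom d (lower W 1 ν)) (allSubsets r)) ⟩
  sumℕ (map (λ W → productℕ (map (λ i → binomℤ d (lower W 1 ν i)) (allFin r))) (allSubsets r))
    ≡⟨ sum-allSubsets-∏ r (λ i b → binomℤ d (ν i ℤ.- + (if b then 1 else 0))) ⟩
  productℕ (map (λ i → binomℤ d (ν i ℤ.- + 0) ℕ.+ binomℤ d (ν i ℤ.- + 1)) (allFin r))
    ≡⟨ cong productℕ (ListP.map-cong (λ i → binomℤ-pascal d (ν i)) (allFin r)) ⟩
  productℕ (map (λ i → binomℤ (suc d) (ν i)) (allFin r)) ∎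
  where
  open ≡-Reasoning
  Us = nonemptySubsets r
  lowered : Subset r → ℕ
  lowered W = distributions Us d (lower W 1 ν)
  ν≗lower⊥ : ν ≗ lower ⊥ 1 ν
  ν≗lower⊥ i rewrite dec-false (i ∈? ⊥) ∉⊥ = sym (ℤP.+-identityʳ (ν i))

allSubsets-unique : ∀ r → Unique (allSubsets r)
allSubsets-unique zero    = [] ∷ []
allSubsets-unique (suc r) =
  UniqueP.++⁺ (UniqueP.map⁺ (cong Vec.tail) (allSubsets-unique r))
              (UniqueP.map⁺ (cong Vec.tail) (allSubsets-unique r)) disjoint
  where
  disjoint : ∀ {W} → ¬ (W ∈ map (outside ∷_) (allSubsets r) × W ∈ map (inside ∷_) (allSubsets r))
  disjoint (W∈out , W∈in) with ∈-map⁻ (outside ∷_) W∈out | ∈-map⁻ (inside ∷_) W∈in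
  ... | _ , _ , refl | _ , _ , eq with cong Vec.head eq
  ... | ()

nonemptySubsets-unique : ∀ r → Unique (nonemptySubsets r)
nonemptySubsets-unique r = UniqueP.filter⁺ nonempty? (allSubsets-unique r)

solutionWeight : ∀ {r} → ℕ → (Fin r → ℤ) → ℕ → Tuple r → ℕ
solutionWeight {r} d ν k s = if does (InS? ν k s) then multinomial d (nonemptySubsets r) s else 0

P*innerTerm≡solutionWeight : ∀ {r} d (ν : Fin r → ℤ) k s →
  ℕtoℚ (d P k) ℚ.* (if does (InS? ν k s) then invFactProd s else 0ℚ) ≡ ℕtoℚ (solutionWeight d ν k s)
P*innerTerm≡solutionWeight {r} d ν k s = by-cases (InS? ν k s)
  where
  by-cases : (inS? : Dec (InS ν k s)) →
    ℕtoℚ (d P k) ℚ.* (if does inS? then invFactProd s else 0ℚ)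
    ≡ ℕtoℚ (if does inS? then multinomial d (nonemptySubsets r) s else 0)
  by-cases (yes (_ , w≡k)) = trans (cong (λ n → ℕtoℚ n ℚ.* invFactProd s) (sym m*f≡P))
                                   (ℕtoℚ-*-/ (multinomial d (nonemptySubsets r) s) (factProd s) {{factProdList≢0 s (nonemptySubsets r)}})
    where
    m*f≡P : multinomial d (nonemptySubsets r) s ℕ.* factProd s ≡ d P k
    m*f≡P = trans (multinomial*factProdOn≡P d (nonemptySubsets r) s) (cong (d P_) w≡k)
  by-cases (no _) = ℚP.*-zeroʳ (ℕtoℚ (d P k))

partialSum≡ℕtoℚ : ∀ {r} d (ν : Fin r → ℤ) M →
  partialSum d ν M ≡ ℕtoℚ (∑< (suc M) (λ k → sumℕ (map (solutionWeight d ν k) (assignments (nonemptySubsets r) k))))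
partialSum≡ℕtoℚ {r} d ν M =
  trans (cong sumℚ (ListP.map-cong term (upTo (suc M))))
        (ℕtoℚ-sum (λ k → sumℕ (map (solutionWeight d ν k) (assignmentsOf k))) (upTo (suc M)))
  where
  assignmentsOf = assignments (nonemptySubsets r)
  term : ∀ k → ℕtoℚ (d P k) ℚ.* innerSum ν k ≡ ℕtoℚ (sumℕ (map (solutionWeight d ν k) (assignmentsOf k)))
  term k = trans (ℚSum.*-distribˡ-sum-map (ℕtoℚ (d P k)) _ (assignmentsOf k))
           (trans (cong sumℚ (ListP.map-cong (P*innerTerm≡solutionWeight d ν k) (assignmentsOf k)))
                  (ℕtoℚ-sum (solutionWeight d ν k) (assignmentsOf k)))

∑<-solutionWeight≡weightSum : ∀ {r} d (ν : Fin r → ℤ) M → d ≤ M →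
  ∑< (suc M) (λ k → sumℕ (map (solutionWeight d ν k) (assignments (nonemptySubsets r) k)))
  ≡ weightSum (nonemptySubsets r) M d ν
∑<-solutionWeight≡weightSum {r} d ν M d≤M = begin
  ∑< (suc M) (λ k → sumℕ (map (solutionWeight d ν k) (assignments Us k)))
    ≡⟨ ∑<-cong-< (suc M) (λ k k<1+M → sym (sum-assignments-extend (nonemptySubsets-unique r)
         (solutionWeight d ν k) (ℕP.≤-pred k<1+M) (solutionWeight-vanish k))) ⟩
  ∑< (suc M) (λ k → sumℕ (map (solutionWeight d ν k) (assignments Us M)))
    ≡⟨ sum-map-comm (solutionWeight d ν) (upTo (suc M)) (assignments Us M) ⟩
  sumℕ (map (λ s → ∑< (suc M) (λ k → solutionWeight d ν k s)) (assignments Us M))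
    ≡⟨ cong sumℕ (ListP.map-cong collapse (assignments Us M)) ⟩
  weightSum Us M d ν ∎
  where
  open ≡-Reasoning
  Us = nonemptySubsets r
  solutionWeight-vanish : ∀ k s → k < totalSum s → solutionWeight d ν k s ≡ 0
  solutionWeight-vanish k s k<w with does (covers? Us ν s)
  ... | false = refl
  ... | true rewrite dec-false (totalSum s ℕ.≟ k) (λ w≡k → ℕP.<-irrefl (sym w≡k) k<w) = refl
  collapse : ∀ s → ∑< (suc M) (λ k → solutionWeight d ν k s) ≡ weight Us d ν s
  collapse s with does (covers? Us ν s)
  ... | false = sum-map-zero (upTo (suc M)) (λ _ → refl)
  ... | true  = ∑<-indicator (suc M) (totalSum s) (multinomial d Us s)
                  (λ M<w → multinomial-vanish Us s (ℕP.≤-<-trans d≤M M<w))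

theorem5 : (d r : ℕ) → 1 ≤ r → (ν : Fin r → ℤ) →
    ∃[ N ] ((M : ℕ) → N ≤ M → partialSum d ν M ≡ rhs d ν)
theorem5 d r _ ν = d , λ M d≤M → begin
  partialSum d ν M
    ≡⟨ partialSum≡ℕtoℚ d ν M ⟩
  ℕtoℚ (∑< (suc M) (λ k → sumℕ (map (solutionWeight d ν k) (assignments Us k))))
    ≡⟨ cong ℕtoℚ (∑<-solutionWeight≡weightSum d ν M d≤M) ⟩
  ℕtoℚ (weightSum Us M d ν)
    ≡⟨ cong ℕtoℚ (weightSum≡distributions (nonemptySubsets-unique r) ν d≤M) ⟩
  ℕtoℚ (distributions Us d ν)
    ≡⟨ cong ℕtoℚ (distributions-nonempty≡∏binom d ν) ⟩
  rhs d ν ∎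
  where
  open ≡-Reasoning
  Us = nonemptySubsets r
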